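{- Let $G$ be a connected graph that admits no $(q,k)$-good edge separation. Let $F$ be a set of at most $k$ edges of $G$, and let $C_0,C_1,\ldots,C_\ell$ be the connected components of $G\setminus F$. Then (i) $\ell\le k$, and (ii) all the components $C_i$ except at most one contain at most $q$ vertices.
   Context: For a connected graph $G$, a partition $(V_1,V_2)$ of $V(G)$ is a $(q,k)$-good edge separation if (i) $|V_1|,|V_2|>q$; (ii) the number of edges with one endpoint in $V_1$ and the other in $V_2$ is at most $k$; (iii) $G[V_1]$ and $G[V_2]$ are connected. -}

module Defs where

open import Data.Nat using (ℕ; _≤_; _<_; _+_)
open import Data.Bool using (Bool; true; false; _∧_; not; if_then_else_)
open import Data.Fin using (Fin)
open import Data.Fin.Properties using (_≟_; _<?_)
open import Data.Fin.Subset using (Subset; _∈_; _∉_; ∁; ∣_∣)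
open import Data.List using (List; map; allFin)
open import Data.Nat.ListAction using (sum)
open import Data.Vec using (lookup; tabulate)
open import Data.Product using (Σ; _×_; ∃)
open import Data.Unit using (⊤)
open import Relation.Nullary using (does; ¬_)
open import Relation.Binary.PropositionalEquality using (_≡_)

record Graph (n : ℕ) : Set where
  field
    adj    : Fin n → Fin n → Bool
    sym    : ∀ u v → adj u v ≡ adj v u
    irrefl : ∀ u → adj u u ≡ false
open Graph public

data Walk {n : ℕ} (A : Fin n → Fin n → Bool) (P : Fin n → Set) : Fin n → Fin n → Set where
  nil  : ∀ {u} → P u → Walk A P u u
  cons : ∀ {u v w} → P u → A u v ≡ true → Walk A P v w → Walk A P u w

Connected : ∀ {n} → Graph n → Set
Connected {n} G = ∀ (u v : Fin n) → Walk (adj G) (λ _ → ⊤) u v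

InducedConnected : ∀ {n} → Graph n → Subset n → Set
InducedConnected {n} G V = ∀ (u v : Fin n) → u ∈ V → v ∈ V → Walk (adj G) (_∈ V) u v

-- Number of edges with one endpoint in V and the other outside V
-- (each such edge counted once, as the ordered pair (u ∈ V, v ∉ V)).
crossingEdges : ∀ {n} → Graph n → Subset n → ℕ
crossingEdges {n} G V =
  sum (map (λ u → sum (map (λ v →
    if lookup V u ∧ not (lookup V v) ∧ adj G u v then 1 else 0) (allFin n))) (allFin n))

-- (q,k)-good edge separation (V₁ , V₂ = complement of V₁).
GoodEdgeSeparation : ∀ {n} → ℕ → ℕ → Graph n → Subset n → Set
GoodEdgeSeparation q k G V₁ =
  q < ∣ V₁ ∣ × q < ∣ ∁ V₁ ∣ × crossingEdges G V₁ ≤ k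
  × InducedConnected G V₁ × InducedConnected G (∁ V₁)

record EdgeSet {n : ℕ} (G : Graph n) : Set where
  field
    mem    : Fin n → Fin n → Bool
    memSym : ∀ u v → mem u v ≡ mem v u
    sub    : ∀ u v → mem u v ≡ true → adj G u v ≡ true
open EdgeSet public

-- Number of edges in F (unordered pairs {u,v}, counted via u < v).
edgeCount : ∀ {n} {G : Graph n} → EdgeSet G → ℕ
edgeCount {n} F =
  sum (map (λ u → sum (map (λ v →
    if does (u <? v) ∧ mem F u v then 1 else 0) (allFin n))) (allFin n))

deleteAdj : ∀ {n} (G : Graph n) → EdgeSet G → Fin n → Fin n → Bool
deleteAdj G F u v = adj G u v ∧ not (mem F u v)

-- c labels the connected components of G ∖ F as C₀,…,C_ℓ :
-- every label is used, and c u ≡ c v iff u and v are joined by a walk in G ∖ F.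
IsComponentLabelling : ∀ {n} (G : Graph n) (F : EdgeSet G) (ℓ : ℕ) → (Fin n → Fin (Data.Nat.suc ℓ)) → Set
IsComponentLabelling {n} G F ℓ c =
  (∀ i → ∃ λ v → c v ≡ i)
  × (∀ u v → (c u ≡ c v → Walk (deleteAdj G F) (λ _ → ⊤) u v)
           × (Walk (deleteAdj G F) (λ _ → ⊤) u v → c u ≡ c v))

component : ∀ {n ℓ} → (Fin n → Fin (Data.Nat.suc ℓ)) → Fin (Data.Nat.suc ℓ) → Subset n
component c i = tabulate (λ v → does (c v ≟ i))

-- Contract the components of G ∖ F to single vertices. Since G is connected, the resulting
-- graph on the labels 0, …, ℓ is connected, and a breadth-first search tree from label 0 uses
-- ℓ distinct edges of F, so ℓ ≤ |F| ≤ k. If two components C_a ≠ C_b had more than q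
-- vertices, root such a tree at a and let V₁ be the union of the components in the subtree
-- of b. Both V₁ and its complement induce connected subgraphs (every component in them is
-- joined to b, resp. a, along tree edges), only edges of F leave V₁, and the two sides contain
-- C_b and C_a: a (q,k)-good edge separation, which G does not admit.
module Submission where

open import Defs renaming (sym to adj-sym)
open import Data.Bool using (Bool; true; false; _∧_; not; if_then_else_)
open import Data.Bool.Properties using (∧-conicalˡ; ∧-conicalʳ; ∧-zeroʳ)
open import Data.Empty using (⊥-elim)
open import Data.Fin using (Fin; zero; suc)
open import Data.Fin.Properties using (_≟_; _<?_; <-cmp; any?)
open import Relation.Binary.Definitions using (tri<; tri≈; tri>)
open import Data.Fin.Subset using (Subset; _∈_; ∁; ∣_∣)
open import Data.Fin.Subset.Properties using (p⊆q⇒∣p∣≤∣q∣; x∈∁p⇒x∉p; x∉p⇒x∈∁p)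
open import Data.List using (map; allFin; tabulate)
open import Data.List.Properties using (map-tabulate)
open import Data.Nat using (ℕ; zero; suc; _+_; _≤_; _<_; z≤n; s≤s)
open import Data.Nat.Induction using (<-rec)
open import Data.Nat.ListAction using () renaming (sum to listSum)
open import Data.Nat.Properties
  using (≤-refl; ≤-reflexive; ≤-trans; ≤-pred; <-≤-trans; <⇒≯; ≮⇒≥; +-mono-≤; m≤m+n; m≤n+m;
         +-identityʳ; *-cancelˡ-≤; anyUpTo?; +-*-semiring; module ≤-Reasoning)
  renaming (_<?_ to _<ℕ?_)
open import Algebra.Properties.Semiring.Sum +-*-semiring
  using (sum-syntax; sum-cong-≗; sum-replicate-zero; ∑-comm; ∑-distrib-+)
open import Data.Product using (∃; ∃₂; _×_; _,_; proj₁; proj₂; map₂)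
open import Data.Sum using (_⊎_; inj₁; inj₂)
open import Data.Vec using (lookup)
import Data.Vec as Vec
open import Data.Vec.Properties using ([]=⇒lookup; lookup⇒[]=; lookup∘tabulate)
open import Function using (_∘_; flip)
open import Relation.Binary.Construct.Closure.ReflexiveTransitive using (Star; ε; _◅_)
open import Relation.Binary.PropositionalEquality
  using (_≡_; _≢_; refl; sym; trans; cong; subst; subst₂; module ≡-Reasoning)
open import Relation.Nullary using (Dec; yes; no; does; ¬_; contradiction)
open import Relation.Nullary.Decidable using (dec-true; dec-false; _×-dec_; _⊎-dec_)

private
  variable
    n m : ℕ

sum-map-allFin : (f : Fin n → ℕ) → listSum (map f (allFin n)) ≡ ∑[ i < n ] f i
sum-map-allFin f = trans (cong listSum (map-tabulate (λ i → i) f)) (sum-tabulate f)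
  where
  sum-tabulate : ∀ {n} (g : Fin n → ℕ) → listSum (tabulate g) ≡ ∑[ i < n ] g i
  sum-tabulate {zero}  g = refl
  sum-tabulate {suc n} g = cong (g zero +_) (sum-tabulate (g ∘ suc))

∑-mono-≤ : {f g : Fin n → ℕ} → (∀ i → f i ≤ g i) → ∑[ i < n ] f i ≤ ∑[ i < n ] g i
∑-mono-≤ {zero}  f≤g = z≤n
∑-mono-≤ {suc n} f≤g = +-mono-≤ (f≤g zero) (∑-mono-≤ (f≤g ∘ suc))

term≤∑ : (f : Fin n → ℕ) (i : Fin n) → f i ≤ ∑[ j < n ] f j
term≤∑ f zero    = m≤m+n (f zero) _
term≤∑ f (suc i) = ≤-trans (term≤∑ (f ∘ suc) i) (m≤n+m _ (f zero))

length≤∑ : {f : Fin n → ℕ} → (∀ i → 1 ≤ f i) → n ≤ ∑[ i < n ] f i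
length≤∑ {zero}  _   = z≤n
length≤∑ {suc n} 1≤f = +-mono-≤ (1≤f zero) (length≤∑ (1≤f ∘ suc))

∑-select : (x : Fin n) (y : ℕ) → ∑[ i < n ] (if does (x ≟ i) then y else 0) ≡ y
∑-select {suc n} zero    y = trans (cong (y +_) (sum-replicate-zero n)) (+-identityʳ y)
∑-select {suc n} (suc x) y = ∑-select x y

nonzeroFibres≤∑ : (c : Fin n → Fin (suc m)) (f : Fin n → ℕ) →
                        (∀ i → ∃ λ u → c u ≡ suc i × 1 ≤ f u) → m ≤ ∑[ u < n ] f u
nonzeroFibres≤∑ {n} {m} c f positive = begin
  m                            ≤⟨ length≤∑ (λ i → fibre-positive (positive i)) ⟩
  ∑[ i < m ] fibre (suc i)     ≤⟨ m≤n+m _ (fibre zero) ⟩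
  ∑[ i < suc m ] fibre i       ≡⟨ ∑-comm (λ i u → if does (c u ≟ i) then f u else 0) ⟩
  ∑[ u < n ] ∑[ i < suc m ] (if does (c u ≟ i) then f u else 0)
                               ≡⟨ sum-cong-≗ (λ u → ∑-select (c u) (f u)) ⟩
  ∑[ u < n ] f u               ∎
  where
  open ≤-Reasoning
  fibre : Fin (suc m) → ℕ
  fibre i = ∑[ u < n ] (if does (c u ≟ i) then f u else 0)
  fibre-positive : ∀ {i} → (∃ λ u → c u ≡ i × 1 ≤ f u) → 1 ≤ fibre i
  fibre-positive (u , refl , 1≤fu) = ≤-trans 1≤fu (≤-trans fu≤term (term≤∑ _ u))
    where
    fu≤term : f u ≤ (if does (c u ≟ c u) then f u else 0)
    fu≤term = ≤-reflexive (cong (λ b → if b then f u else 0) (sym (dec-true (c u ≟ c u) refl)))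

𝟙 : Bool → ℕ
𝟙 b = if b then 1 else 0

count : (Fin n → Fin n → Bool) → ℕ
count {n} R = ∑[ u < n ] ∑[ v < n ] 𝟙 (R u v)

listCount≡count : (R : Fin n → Fin n → Bool) →
  listSum (map (λ u → listSum (map (λ v → 𝟙 (R u v)) (allFin n))) (allFin n)) ≡ count R
listCount≡count {n} R = trans (sum-map-allFin (λ u → listSum (map (λ v → 𝟙 (R u v)) (allFin n))))
                                (sum-cong-≗ (λ u → sum-map-allFin (λ v → 𝟙 (R u v))))

count-flip : (R : Fin n → Fin n → Bool) → count (flip R) ≡ count R
count-flip R = ∑-comm (λ u v → 𝟙 (R v u))

count+count : (R : Fin n → Fin n → Bool) →
              count R + count R ≡ ∑[ u < n ] ∑[ v < n ] (𝟙 (R u v) + 𝟙 (R v u))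
count+count {n} R = begin
  count R + count R
    ≡⟨ cong (count R +_) (sym (count-flip R)) ⟩
  count R + count (flip R)
    ≡⟨ sym (∑-distrib-+ (λ u → ∑[ v < n ] 𝟙 (R u v)) (λ u → ∑[ v < n ] 𝟙 (R v u))) ⟩
  ∑[ u < n ] (∑[ v < n ] 𝟙 (R u v) + ∑[ v < n ] 𝟙 (R v u))
    ≡⟨ sum-cong-≗ (λ u → sym (∑-distrib-+ (λ v → 𝟙 (R u v)) (λ v → 𝟙 (R v u)))) ⟩
  ∑[ u < n ] ∑[ v < n ] (𝟙 (R u v) + 𝟙 (R v u))
    ∎
  where open ≡-Reasoning

-- Both counts are halves of the symmetrised counts.
count-mono-pairs : (R S : Fin n → Fin n → Bool) →
                   (∀ u v → 𝟙 (R u v) + 𝟙 (R v u) ≤ 𝟙 (S u v) + 𝟙 (S v u)) → count R ≤ count S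
count-mono-pairs R S pairs≤ = *-cancelˡ-≤ 2 (begin
  count R + (count R + 0)  ≡⟨ cong (count R +_) (+-identityʳ _) ⟩
  count R + count R        ≡⟨ count+count R ⟩
  _                        ≤⟨ ∑-mono-≤ (λ u → ∑-mono-≤ (pairs≤ u)) ⟩
  _                        ≡⟨ sym (count+count S) ⟩
  count S + count S        ≡⟨ cong (count S +_) (sym (+-identityʳ _)) ⟩
  count S + (count S + 0)  ∎)
  where open ≤-Reasoning

module _ {G : Graph n} (F : EdgeSet G) where

  mem-irrefl : ∀ u → mem F u u ≡ false
  mem-irrefl u with mem F u u in e
  ... | false = refl
  ... | true with () ← trans (sym (sub F u u e)) (irrefl G u)

  ascending : Fin n → Fin n → Bool
  ascending u v = does (u <? v) ∧ mem F u v

  edgeCount≡count : edgeCount F ≡ count ascending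
  edgeCount≡count = listCount≡count ascending

  𝟙-ascending-pair : ∀ u v → 𝟙 (ascending u v) + 𝟙 (ascending v u) ≡ 𝟙 (mem F u v)
  𝟙-ascending-pair u v with <-cmp u v
  ... | tri< u<v _ v≮u rewrite dec-true (u <? v) u<v | dec-false (v <? u) v≮u = +-identityʳ _
  ... | tri≈ u≮u refl _ rewrite dec-false (u <? u) u≮u | mem-irrefl u = refl
  ... | tri> u≮v _ v<u rewrite dec-false (u <? v) u≮v | dec-true (v <? u) v<u = cong 𝟙 (memSym F v u)

  module _ (R : Fin n → Fin n → Bool)
           (R⊆F : ∀ {u v} → R u v ≡ true → mem F u v ≡ true)
           (R-antisym : ∀ {u v} → R u v ≡ true → R v u ≡ false) where

    𝟙-antisym-pair≤ : ∀ u v → 𝟙 (R u v) + 𝟙 (R v u) ≤ 𝟙 (mem F u v)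
    𝟙-antisym-pair≤ u v with R u v in uv | R v u in vu
    ... | true  | true  with () ← trans (sym vu) (R-antisym uv)
    ... | true  | false rewrite R⊆F uv = ≤-refl
    ... | false | true  rewrite memSym F u v | R⊆F vu = ≤-refl
    ... | false | false = z≤n

    count-antisym≤edgeCount : count R ≤ edgeCount F
    count-antisym≤edgeCount = begin
      count R          ≤⟨ count-mono-pairs R ascending pair≤ ⟩
      count ascending  ≡⟨ sym edgeCount≡count ⟩
      edgeCount F      ∎
      where
      open ≤-Reasoning
      pair≤ : ∀ u v → 𝟙 (R u v) + 𝟙 (R v u) ≤ 𝟙 (ascending u v) + 𝟙 (ascending v u)
      pair≤ u v = ≤-trans (𝟙-antisym-pair≤ u v) (≤-reflexive (sym (𝟙-ascending-pair u v)))

does-true⇒ : ∀ {A : Set} (a? : Dec A) → does a? ≡ true → A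
does-true⇒ (yes a) _ = a

module _ {P : Fin n → Set} (P? : ∀ x → Dec (P x)) where

  toSubset : Subset n
  toSubset = Vec.tabulate (λ x → does (P? x))

  ∈toSubset⁺ : ∀ {x} → P x → x ∈ toSubset
  ∈toSubset⁺ {x} Px = lookup⇒[]= x toSubset (trans (lookup∘tabulate _ x) (dec-true (P? x) Px))

  ∈toSubset⁻ : ∀ {x} → x ∈ toSubset → P x
  ∈toSubset⁻ {x} x∈ = does-true⇒ (P? x) (trans (sym (lookup∘tabulate _ x)) ([]=⇒lookup x∈))

  ∈∁toSubset⁺ : ∀ {x} → ¬ P x → x ∈ ∁ toSubset
  ∈∁toSubset⁺ ¬Px = x∉p⇒x∈∁p (¬Px ∘ ∈toSubset⁻)

  ∈∁toSubset⁻ : ∀ {x} → x ∈ ∁ toSubset → ¬ P x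
  ∈∁toSubset⁻ x∈∁ = x∈∁p⇒x∉p x∈∁ ∘ ∈toSubset⁺

module _ {A : Fin n → Fin n → Bool} where

  Walk-map : ∀ {P Q : Fin n → Set} → (∀ {w} → P w → Q w) → ∀ {u v} → Walk A P u v → Walk A Q u v
  Walk-map P⇒Q (nil Pu)        = nil (P⇒Q Pu)
  Walk-map P⇒Q (cons Pu uv vw) = cons (P⇒Q Pu) uv (Walk-map P⇒Q vw)

  Walk-head : ∀ {P u v} → Walk A P u v → P u
  Walk-head (nil Pu)      = Pu
  Walk-head (cons Pu _ _) = Pu

  _++ʷ_ : ∀ {P u v w} → Walk A P u v → Walk A P v w → Walk A P u w
  nil _         ++ʷ vw = vw
  cons Pu uv vw ++ʷ wx = cons Pu uv (vw ++ʷ wx)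

  Walk-reverse : (∀ u v → A u v ≡ A v u) → ∀ {P u v} → Walk A P u v → Walk A P v u
  Walk-reverse A-sym (nil Pu)                = nil Pu
  Walk-reverse A-sym (cons {u} {v} Pu uv vw) =
    Walk-reverse A-sym vw ++ʷ cons (Walk-head vw) (trans (A-sym v u) uv) (nil Pu)

Walk-restrict : ∀ {A B : Fin n → Fin n → Bool} {P Q : Fin n → Set} →
                (∀ {x y} → A x y ≡ true → B x y ≡ true) →
                (∀ {x y} → A x y ≡ true → Q x → Q y) →
                ∀ {u v} → Q u → Walk A P u v → Walk B Q u v
Walk-restrict A⇒B step Qu (nil _)        = nil Qu
Walk-restrict A⇒B step Qu (cons _ uv vw) = cons Qu (A⇒B uv) (Walk-restrict A⇒B step (step uv Qu) vw)

-- Breadth-first search trees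

Least : (ℕ → Set) → ℕ → Set
Least P d = P d × (∀ {s} → s < d → ¬ P s)

least : ∀ {P : ℕ → Set} → (∀ t → Dec (P t)) → ∀ {t} → P t → ∃ (Least P)
least {P} P? {t} = <-rec (λ t → P t → ∃ (Least P)) step t
  where
  step : ∀ t → (∀ {s} → s < t → P s → ∃ (Least P)) → P t → ∃ (Least P)
  step t rec Pt with anyUpTo? P? t
  ... | yes (s , s<t , Ps) = rec s<t Ps
  ... | no  none           = t , Pt , λ s<t Ps → none (_ , s<t , Ps)

Layer : (Fin m → Fin m → Set) → Fin m → ℕ → Fin m → Set
Layer E r zero    i = i ≡ r
Layer E r (suc t) i = Layer E r t i ⊎ ∃ λ j → Layer E r t j × E j i

record RootedTree (E : Fin m → Fin m → Set) (r : Fin m) : Set where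
  field
    parent       : Fin m → Fin m
    depth        : Fin m → ℕ
    parent-edge  : ∀ {i} → i ≢ r → E (parent i) i
    depth-parent : ∀ {i} → i ≢ r → depth (parent i) < depth i

bfsTree : {E : Fin m → Fin m → Set} {r : Fin m} → (∀ i j → Dec (E i j)) →
          (∀ i → Star E r i) → RootedTree E r
bfsTree {m} {E} {r} E? reachable = record
  { parent       = toParent ∘ parentOf
  ; depth        = depth
  ; parent-edge  = λ {i} i≢r → proj₁ (toParent-spec (parentOf i) i≢r)
  ; depth-parent = λ {i} i≢r → proj₂ (toParent-spec (parentOf i) i≢r)
  }
  where
  layer? : ∀ t i → Dec (Layer E r t i)
  layer? zero    i = i ≟ r
  layer? (suc t) i = layer? t i ⊎-dec any? (λ j → layer? t j ×-dec E? j i)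

  layer-star : ∀ {t i j} → Layer E r t i → Star E i j → ∃ λ t′ → Layer E r t′ j
  layer-star L ε        = _ , L
  layer-star L (e ◅ es) = layer-star (inj₂ (_ , L , e)) es

  shallowest : ∀ i → ∃ (Least λ d → Layer E r d i)
  shallowest i = least (λ t → layer? t i) (proj₂ (layer-star refl (reachable i)))

  depth : Fin m → ℕ
  depth i = proj₁ (shallowest i)

  depth≤ : ∀ {t i} → Layer E r t i → depth i ≤ t
  depth≤ {i = i} L = ≮⇒≥ (λ t<d → proj₂ (proj₂ (shallowest i)) t<d L)

  ParentOf : Fin m → ℕ → Set
  ParentOf i d = i ≡ r ⊎ ∃ λ j → E j i × depth j < d

  fromLeastLayer : ∀ {i d} → Least (λ d → Layer E r d i) d → ParentOf i d
  fromLeastLayer {d = zero}  (i≡r , _)                = inj₁ i≡r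
  fromLeastLayer {d = suc t} (inj₁ L , shallower)     = ⊥-elim (shallower ≤-refl L)
  fromLeastLayer {d = suc t} (inj₂ (j , L , e) , _)   = inj₂ (j , e , s≤s (depth≤ L))

  parentOf : ∀ i → ParentOf i (depth i)
  parentOf i = fromLeastLayer (proj₂ (shallowest i))

  toParent : ∀ {i d} → ParentOf i d → Fin m
  toParent (inj₁ _)       = r
  toParent (inj₂ (j , _)) = j

  toParent-spec : ∀ {i d} (p : ParentOf i d) → i ≢ r → E (toParent p) i × depth (toParent p) < d
  toParent-spec (inj₁ i≡r)          i≢r = ⊥-elim (i≢r i≡r)
  toParent-spec (inj₂ (_ , e , lt)) _   = e , lt

-- The graph of components of G ∖ F

module Components {G : Graph n} (F : EdgeSet G) {ℓ} (c : Fin n → Fin (suc ℓ))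
                  (c-labels : IsComponentLabelling G F ℓ c) where

  Label : Set
  Label = Fin (suc ℓ)

  Linked : Label → Label → Set
  Linked i j = ∃₂ λ u v → c u ≡ i × c v ≡ j × mem F u v ≡ true

  linked? : ∀ i j → Dec (Linked i j)
  linked? i j = any? λ u → any? λ v → (c u ≟ i) ×-dec (c v ≟ j) ×-dec (mem F u v Data.Bool.≟ true)

  representative : Label → Fin n
  representative i = proj₁ (proj₁ c-labels i)

  c-representative : ∀ i → c (representative i) ≡ i
  c-representative i = proj₂ (proj₁ c-labels i)

  ∈component⁻ : ∀ {x i} → x ∈ component c i → c x ≡ i
  ∈component⁻ {i = i} = ∈toSubset⁻ (λ v → c v ≟ i)

  deleteAdj⇒sameLabel : ∀ {u v} → deleteAdj G F u v ≡ true → c u ≡ c v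
  deleteAdj⇒sameLabel {u} {v} uv = proj₂ (proj₂ c-labels u v) (cons _ uv (nil _))

  sameLabel⇒walk : ∀ {u v} → c u ≡ c v → Walk (adj G) (λ w → c w ≡ c u) u v
  sameLabel⇒walk {u} {v} cu≡cv =
    Walk-restrict (∧-conicalˡ _ _) (λ xy cx≡cu → trans (sym (deleteAdj⇒sameLabel xy)) cx≡cu) refl
                  (proj₁ (proj₂ c-labels u v) cu≡cv)

  walk⇒linkPath : ∀ {P u v} → Walk (adj G) P u v → Star Linked (c u) (c v)
  walk⇒linkPath (nil _) = ε
  walk⇒linkPath (cons {u} {v} {w} _ uv vw) with mem F u v in uv∈F
  ... | true  = (u , v , refl , refl , uv∈F) ◅ walk⇒linkPath vw
  ... | false = subst (λ i → Star Linked i (c w)) (sym (deleteAdj⇒sameLabel uv∉F)) (walk⇒linkPath vw)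
    where
    uv∉F : deleteAdj G F u v ≡ true
    uv∉F rewrite uv | uv∈F = refl

  labelTree : Connected G → (r : Label) → RootedTree Linked r
  labelTree connected r = bfsTree linked? λ i →
    subst₂ (Star Linked) (c-representative r) (c-representative i)
           (walk⇒linkPath (connected (representative r) (representative i)))

  module _ {r} (T : RootedTree Linked r) where
    open RootedTree T

    ParentClosedExcept : (Label → Set) → Label → Set
    ParentClosedExcept D h = ∀ {i} → D i → i ≢ h → i ≢ r × D (parent i)

    walkToHub : (D : Label → Set) (h : Label) → ParentClosedExcept D h →
                ∀ u → D (c u) → Walk (adj G) (D ∘ c) u (representative h)
    walkToHub D h closed u Du = go (suc (depth (c u))) u ≤-refl Du
      where
      inComponent : ∀ {u v} → D (c u) → c u ≡ c v → Walk (adj G) (D ∘ c) u v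
      inComponent Du cu≡cv = Walk-map (λ cw≡cu → subst D (sym cw≡cu) Du) (sameLabel⇒walk cu≡cv)

      go : ∀ N u → depth (c u) < N → D (c u) → Walk (adj G) (D ∘ c) u (representative h)
      go (suc N) u lt Du with c u ≟ h
      ... | yes cu≡h = inComponent Du (trans cu≡h (sym (c-representative h)))
      ... | no  cu≢h with closed Du cu≢h
      ...   | cu≢r , Dparent with parent-edge cu≢r
      ...     | x , y , cx , cy , xy∈F =
        inComponent Du (sym cy)
        ++ʷ cons (subst D (sym cy) Du) (sub F y x (trans (memSym F y x) xy∈F))
                 (go N x (subst (λ j → depth j < N) (sym cx) (<-≤-trans (depth-parent cu≢r) (≤-pred lt)))
                     (subst D (sym cx) Dparent))

    walkWithin : (D : Label → Set) (h : Label) → ParentClosedExcept D h →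
                 ∀ u v → D (c u) → D (c v) → Walk (adj G) (D ∘ c) u v
    walkWithin D h closed u v Du Dv =
      walkToHub D h closed u Du ++ʷ Walk-reverse (adj-sym G) (walkToHub D h closed v Dv)

  crossingEdges-componentUnion≤edgeCount : (f : Label → Bool) →
                                          crossingEdges G (Vec.tabulate (f ∘ c)) ≤ edgeCount F
  crossingEdges-componentUnion≤edgeCount f =
    subst (_≤ edgeCount F) (sym (listCount≡count cut)) (count-antisym≤edgeCount F cut cut⊆F cut-antisym)
    where
    V : Subset n
    V = Vec.tabulate (f ∘ c)

    cut : Fin n → Fin n → Bool
    cut u v = lookup V u ∧ not (lookup V v) ∧ adj G u v

    cut-antisym : ∀ {u v} → cut u v ≡ true → cut v u ≡ false
    cut-antisym {u} {v} uv rewrite ∧-conicalˡ (lookup V u) _ uv = ∧-zeroʳ (lookup V v)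

    cut⊆F : ∀ {u v} → cut u v ≡ true → mem F u v ≡ true
    cut⊆F {u} {v} uv with mem F u v in uv∈F
    ... | true  = refl
    ... | false = contradiction sameSide (sidesDiffer (lookup V u) (lookup V v) uv)
      where
      uv∉F : deleteAdj G F u v ≡ true
      uv∉F rewrite ∧-conicalʳ (not (lookup V v)) (adj G u v) (∧-conicalʳ (lookup V u) _ uv) | uv∈F = refl
      sameSide : lookup V u ≡ lookup V v
      sameSide = trans (lookup∘tabulate (f ∘ c) u)
                       (trans (cong f (deleteAdj⇒sameLabel uv∉F)) (sym (lookup∘tabulate (f ∘ c) v)))
      sidesDiffer : ∀ x y {z} → x ∧ not y ∧ z ≡ true → x ≢ y
      sidesDiffer true  true  ()
      sidesDiffer true  false _ ()
      sidesDiffer false _     ()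

  module _ (T : RootedTree Linked zero) where
    open RootedTree T

    descending : Fin n → Fin n → Bool
    descending u v = mem F u v ∧ does (depth (c v) <ℕ? depth (c u))

    descending⊆F : ∀ {u v} → descending u v ≡ true → mem F u v ≡ true
    descending⊆F = ∧-conicalˡ _ _

    descending-antisym : ∀ {u v} → descending u v ≡ true → descending v u ≡ false
    descending-antisym {u} {v} uv
      rewrite dec-false (depth (c u) <ℕ? depth (c v))
                        (<⇒≯ (does-true⇒ (depth (c v) <ℕ? depth (c u)) (∧-conicalʳ (mem F u v) _ uv)))
      = ∧-zeroʳ (mem F v u)

    nonzeroLabel-descends : ∀ i → ∃ λ u → c u ≡ suc i × 1 ≤ ∑[ v < n ] 𝟙 (descending u v)
    nonzeroLabel-descends i with parent-edge {suc i} (λ ())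
    ... | x , y , cx , cy , xy∈F = y , cy , ≤-trans (≤-reflexive (cong 𝟙 (sym yx))) (term≤∑ _ x)
      where
      yx : descending y x ≡ true
      yx rewrite trans (memSym F y x) xy∈F | cx | cy
               | dec-true (depth (parent (suc i)) <ℕ? depth (suc i)) (depth-parent (λ ())) = refl

    labels≤edgeCount : ℓ ≤ edgeCount F
    labels≤edgeCount = ≤-trans (nonzeroFibres≤∑ c _ nonzeroLabel-descends)
                               (count-antisym≤edgeCount F descending descending⊆F descending-antisym)

  module Subtree {a b : Label} (T : RootedTree Linked a) (b≢a : b ≢ a) where
    open RootedTree T

    data InSubtree : Label → Set where
      here  : InSubtree b
      child : ∀ {i} → i ≢ a → InSubtree (parent i) → InSubtree i

    ¬InSubtree-root : ¬ InSubtree a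
    ¬InSubtree-root here          = b≢a refl
    ¬InSubtree-root (child a≢a _) = a≢a refl

    inSubtree? : ∀ i → Dec (InSubtree i)
    inSubtree? i = go (suc (depth i)) i ≤-refl
      where
      go : ∀ N i → depth i < N → Dec (InSubtree i)
      go (suc N) i lt with i ≟ b | i ≟ a
      ... | yes refl | _        = yes here
      ... | no  i≢b  | yes refl = no ¬InSubtree-root
      ... | no  i≢b  | no  i≢a  with go N (parent i) (<-≤-trans (depth-parent i≢a) (≤-pred lt))
      ...   | yes inside  = yes (child i≢a inside)
      ...   | no  outside = no λ { here → i≢b refl ; (child _ inside) → outside inside }

    InSubtree-parentClosed : ParentClosedExcept T InSubtree b
    InSubtree-parentClosed here               b≢b = ⊥-elim (b≢b refl)
    InSubtree-parentClosed (child i≢a inside) _   = i≢a , inside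

    ¬InSubtree-parentClosed : ParentClosedExcept T (¬_ ∘ InSubtree) a
    ¬InSubtree-parentClosed outside i≢a = i≢a , outside ∘ child i≢a

    inSubtree?∘c : ∀ u → Dec (InSubtree (c u))
    inSubtree?∘c u = inSubtree? (c u)

    V₁ : Subset n
    V₁ = toSubset inSubtree?∘c

    V₁-connected : InducedConnected G V₁
    V₁-connected u v u∈ v∈ =
      Walk-map (∈toSubset⁺ inSubtree?∘c)
        (walkWithin T InSubtree b InSubtree-parentClosed u v
                    (∈toSubset⁻ inSubtree?∘c u∈) (∈toSubset⁻ inSubtree?∘c v∈))

    ∁V₁-connected : InducedConnected G (∁ V₁)
    ∁V₁-connected u v u∉ v∉ =
      Walk-map (∈∁toSubset⁺ inSubtree?∘c)
        (walkWithin T (¬_ ∘ InSubtree) a ¬InSubtree-parentClosed u v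
                    (∈∁toSubset⁻ inSubtree?∘c u∉) (∈∁toSubset⁻ inSubtree?∘c v∉))

    component-b⊆V₁ : ∀ {x} → x ∈ component c b → x ∈ V₁
    component-b⊆V₁ x∈ = ∈toSubset⁺ inSubtree?∘c (subst InSubtree (sym (∈component⁻ x∈)) here)

    component-a⊆∁V₁ : ∀ {x} → x ∈ component c a → x ∈ ∁ V₁
    component-a⊆∁V₁ x∈ =
      ∈∁toSubset⁺ inSubtree?∘c (subst (¬_ ∘ InSubtree) (sym (∈component⁻ x∈)) ¬InSubtree-root)

    goodSeparation : ∀ {q k} → q < ∣ component c a ∣ → q < ∣ component c b ∣ → edgeCount F ≤ k →
                     GoodEdgeSeparation q k G V₁
    goodSeparation q<Ca q<Cb F≤k =
        <-≤-trans q<Cb (p⊆q⇒∣p∣≤∣q∣ component-b⊆V₁)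
      , <-≤-trans q<Ca (p⊆q⇒∣p∣≤∣q∣ component-a⊆∁V₁)
      , ≤-trans (crossingEdges-componentUnion≤edgeCount (λ i → does (inSubtree? i))) F≤k
      , V₁-connected
      , ∁V₁-connected

  largeComponent-unique : ∀ {q k} → Connected G → edgeCount F ≤ k →
                          (∀ V₁ → ¬ GoodEdgeSeparation q k G V₁) →
                          ∀ {a b} → q < ∣ component c a ∣ → q < ∣ component c b ∣ → a ≡ b
  largeComponent-unique connected F≤k noSeparation {a} {b} q<Ca q<Cb with a ≟ b
  ... | yes a≡b = a≡b
  ... | no  a≢b = ⊥-elim (noSeparation _ (goodSeparation q<Ca q<Cb F≤k))
    where open Subtree (labelTree connected a) (a≢b ∘ sym)

allButOne : ∀ {P : Fin (suc m) → Set} → (∀ i → Dec (P i)) → (∀ {i j} → P i → P j → i ≡ j) →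
            ∃ λ j → ∀ i → i ≢ j → ¬ P i
allButOne P? unique with any? P?
... | no  none       = zero , λ i _ Pi → none (i , Pi)
... | yes (j , Pj)   = j , λ i i≢j Pi → i≢j (unique Pi Pj)

lemma3 : (q k n : ℕ) (G : Graph n) → Connected G
    → ((V₁ : Subset n) → ¬ GoodEdgeSeparation q k G V₁)
    → (F : EdgeSet G) → edgeCount F ≤ k
    → (ℓ : ℕ) (c : Fin n → Fin (suc ℓ)) → IsComponentLabelling G F ℓ c
    → (ℓ ≤ k) × (∃ λ j → ∀ i → ¬ i ≡ j → ∣ component c i ∣ ≤ q)
lemma3 q k n G connected noSeparation F F≤k ℓ c c-labels =
    ≤-trans (labels≤edgeCount (labelTree connected zero)) F≤k
  , map₂ (λ notLarge i i≢j → ≮⇒≥ (notLarge i i≢j))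
      (allButOne (λ i → q <ℕ? ∣ component c i ∣)
                 (largeComponent-unique connected F≤k noSeparation))
  where open Components F c c-labels
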